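{- Let $n\ge1$ and let $\min(x)$ denote the smallest of $x_0,\dots,x_{n-1}$ for $x=(x_0,\dots,x_{n-1})\in\mathbb{F}_p{}^n$. When $p=2$, a minimal polynomial expression of $\min$ is \[ \min(x)=\prod_{i=0}^{n-1}x_i=e_n(x). \] When $p=3$, a minimal polynomial expression of $\min$ is \[ \min(x)=\prod_{i=0}^{n-1}x_i^2+\prod_{i=0}^{n-1}x_i(1-x_i)=e_n\Bigl(1+\sum_{i=1}^n(-1)^ie_i+e_n\Bigr), \] where $e_i=e_i(x)$.
   Context: $\mathbb{F}_p$ is identified with $\{0,1,\dots,p-1\}\subset\mathbb{Z}$ with the usual ordering, used for $\min$. A minimal polynomial expression of a function $\mathbb{F}_p{}^n\to\mathbb{F}_p$ is a polynomial over $\mathbb{F}_p$ of degree at most $p-1$ in each variable coinciding with it as a function. $e_i(x)$ is the $i$-th elementary symmetric polynomial in $x_0,\dots,x_{n-1}$. -}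

module Defs where

open import Data.Nat as ℕ using (ℕ; zero; suc; _⊓_; _≤_; _≡ᵇ_)
open import Data.Integer as ℤ using (ℤ; +_)
open import Data.Integer.Divisibility using (_∣_)
open import Data.Fin using (Fin; toℕ)
import Data.Fin as Fin
open import Data.Bool using (Bool; true; false; _∧_; if_then_else_)
open import Data.Product using (_×_; ∃)
open import Data.Vec.Functional using (_∷_)
open import Relation.Binary.PropositionalEquality using (_≡_)

_≡_[mod_] : ℤ → ℤ → ℕ → Set
a ≡ b [mod p ] = (+ p) ∣ (a ℤ.- b)

-- Polynomial expressions in n variables x₀,…,x_{n-1} with integer constants
-- (read modulo p, i.e. over 𝔽_p).
infixl 6 _⊕_
infixl 7 _⊗_
data Poly (n : ℕ) : Set where
  con : ℤ → Poly n
  var : Fin n → Poly n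
  _⊕_ : Poly n → Poly n → Poly n
  _⊗_ : Poly n → Poly n → Poly n
  neg : Poly n → Poly n

_⊖_ : ∀ {n} → Poly n → Poly n → Poly n
P ⊖ Q = P ⊕ neg Q

eval : ∀ {n} → Poly n → (Fin n → ℤ) → ℤ
eval (con c) x = c
eval (var i) x = x i
eval (P ⊕ Q) x = eval P x ℤ.+ eval Q x
eval (P ⊗ Q) x = eval P x ℤ.* eval Q x
eval (neg P) x = ℤ.- eval P x

Exp : ℕ → Set
Exp n = Fin n → ℕ

expEq : ∀ n → Exp n → Exp n → Bool
expEq zero a b = true
expEq (suc n) a b = (a Fin.zero ≡ᵇ b Fin.zero) ∧ expEq n (λ i → a (Fin.suc i)) (λ i → b (Fin.suc i))

zeroExp : ∀ {n} → Exp n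
zeroExp i = 0

unitExp : ∀ {n} → Fin n → Exp n
unitExp i j = if toℕ i ≡ᵇ toℕ j then 1 else 0

sumUpTo : ℕ → (ℕ → ℤ) → ℤ
sumUpTo zero f = f 0
sumUpTo (suc m) f = sumUpTo m f ℤ.+ f (suc m)

-- Sum of f b over all exponent vectors b ≤ a componentwise, together
-- with the complementary vector a - b.
sumBox : ∀ n → Exp n → (Exp n → Exp n → ℤ) → ℤ
sumBox zero a f = f (λ ()) (λ ())
sumBox (suc n) a f =
  sumUpTo (a Fin.zero) (λ k →
    sumBox n (λ i → a (Fin.suc i))
      (λ b c → f (k ∷ b) ((a Fin.zero ℕ.∸ k) ∷ c)))

coeff : ∀ {n} → Poly n → Exp n → ℤ
coeff {n} (con c) a = if expEq n a zeroExp then c else + 0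
coeff {n} (var i) a = if expEq n a (unitExp i) then + 1 else + 0
coeff (P ⊕ Q) a = coeff P a ℤ.+ coeff Q a
coeff {n} (P ⊗ Q) a = sumBox n a (λ b c → coeff P b ℤ.* coeff Q c)
coeff (neg P) a = ℤ.- coeff P a

PolyEq : ℕ → ∀ {n} → Poly n → Poly n → Set
PolyEq p {n} P Q = ∀ (a : Exp n) → coeff P a ≡ coeff Q a [mod p ]

ReducedDeg : ℕ → ∀ {n} → Poly n → Set
ReducedDeg p {n} P = ∀ (a : Exp n) → (∃ λ (i : Fin n) → p ≤ a i) → coeff P a ≡ + 0 [mod p ]

-- Points of 𝔽_p^n, with 𝔽_p identified with {0,…,p-1}.
toℤpt : ∀ {p n} → (Fin n → Fin p) → Fin n → ℤ
toℤpt x i = + toℕ (x i)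

MinimalPolyExpr : (p n : ℕ) → ((Fin n → Fin p) → ℕ) → Poly n → Set
MinimalPolyExpr p n f P =
  ReducedDeg p P × (∀ (x : Fin n → Fin p) → eval P (toℤpt x) ≡ + f x [mod p ])

-- min(x) of x₀,…,x_{m} (n = suc m ≥ 1 coordinates), in the usual order on ℕ.
minF : ∀ {p} m → (Fin (suc m) → Fin p) → ℕ
minF zero x = toℕ (x Fin.zero)
minF (suc m) x = toℕ (x Fin.zero) ⊓ minF m (λ i → x (Fin.suc i))

sumP : ∀ {n} m → (Fin m → Poly n) → Poly n
sumP zero f = con (+ 0)
sumP (suc m) f = f Fin.zero ⊕ sumP m (λ i → f (Fin.suc i))

prodP : ∀ {n} m → (Fin m → Poly n) → Poly n
prodP zero f = con (+ 1)
prodP (suc m) f = f Fin.zero ⊗ prodP m (λ i → f (Fin.suc i))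

elemSym : ∀ {n} m → (Fin m → Poly n) → ℕ → Poly n
elemSym zero f zero = con (+ 1)
elemSym zero f (suc k) = con (+ 0)
elemSym (suc m) f zero = con (+ 1)
elemSym (suc m) f (suc k) =
  f Fin.zero ⊗ elemSym m (λ i → f (Fin.suc i)) k ⊕ elemSym m (λ i → f (Fin.suc i)) (suc k)

e : ∀ n → ℕ → Poly n
e n k = elemSym n var k

prodX : ∀ n → Poly n
prodX n = prodP n var

min3A : ∀ n → Poly n
min3A n = prodP n (λ i → var i ⊗ var i) ⊕ prodP n (λ i → var i ⊗ (con (+ 1) ⊖ var i))

min3B : ∀ n → Poly n
min3B n = e n n ⊗ (con (+ 1)
                    ⊕ sumP n (λ i → con (ℤ.-1ℤ ℤ.^ suc (toℕ i)) ⊗ e n (suc (toℕ i)))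
                    ⊕ e n n)

-- Expanding products, the coefficient of x^a in P ⊗ Q is a convolution of the coefficients of
-- P and Q, so polynomial expressions up to equality of all coefficients form a commutative ring.
-- In that ring ∏ x_i = e_n and, by the recursion e_{j+1}(x₀, x') = x₀ e_j(x') + e_{j+1}(x'),
-- ∏ (1 - x_i) = Σ_j (-1)^j e_j; this gives both polynomial identities. Each x_i occurs in exactly
-- one factor of each product, so the degree in x_i is at most 1, resp. 2. For the values, write
-- [d ≤ t] for the indicator: [d ≤ min x] = ∏_i [d ≤ x_i], and for t ∈ 𝔽_p one has t = [1 ≤ t]
-- when p = 2, while t² ≡ [1 ≤ t], t (1 - t) ≡ [2 ≤ t] and t = [1 ≤ t] + [2 ≤ t] when p = 3.

module Submission where

open import Defs
open import Data.Nat as ℕ using (ℕ; zero; suc; _≤_; _<_; _∸_; _⊓_; _≡ᵇ_; z≤n; s≤s)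
import Data.Nat.Properties as ℕP
open import Data.Integer as ℤ using (ℤ; +_; _+_; _*_; -_; _-_)
import Data.Integer.Properties as ℤP
import Data.Integer.Divisibility.Signed as ℤD
open import Data.Integer.Tactic.RingSolver using (solve-∀)
open import Data.Fin as Fin using (Fin; toℕ)
import Data.Fin.Properties as FinP
open import Data.Bool using (true; false; T; _∧_; if_then_else_)
open import Data.Bool.Properties using (T-∧)
open import Data.Maybe using (nothing)
open import Data.Product using (_×_; _,_; proj₁; proj₂)
open import Data.Vec.Functional using (_∷_; tail)
open import Function using (id; _∘_; Equivalence)
open import Relation.Nullary using (¬_; yes; no; contradiction)
open import Relation.Nullary.Reflects using (ofʸ; ofⁿ)
open import Relation.Binary.PropositionalEquality
open import Relation.Binary.Bundles using (Setoid)
open import Relation.Binary.Structures using (IsEquivalence)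
open import Algebra.Bundles using (CommutativeRing)
open import Algebra.Structures using (IsCommutativeRing)
open import Algebra.Properties.CommutativeSemigroup ℤP.+-commutativeSemigroup
  using () renaming (interchange to +-interchange)
open import Algebra.Properties.Monoid.Sum ℕP.+-0-monoid using (sum)
open import Tactic.RingSolver.Core.AlmostCommutativeRing using (fromCommutativeRing)

-- Finite sums

sumUpTo-cong : ∀ m {f g : ℕ → ℤ} → (∀ k → k ≤ m → f k ≡ g k) → sumUpTo m f ≡ sumUpTo m g
sumUpTo-cong zero f≡g = f≡g 0 z≤n
sumUpTo-cong (suc m) f≡g =
  cong₂ _+_ (sumUpTo-cong m (λ k k≤m → f≡g k (ℕP.m≤n⇒m≤1+n k≤m))) (f≡g (suc m) ℕP.≤-refl)

sumUpTo-zero : ∀ m {f : ℕ → ℤ} → (∀ k → k ≤ m → f k ≡ + 0) → sumUpTo m f ≡ + 0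
sumUpTo-zero m f≡0 = trans (sumUpTo-cong m f≡0) (sumUpTo-const0 m)
  where
  sumUpTo-const0 : ∀ m → sumUpTo m (λ _ → + 0) ≡ + 0
  sumUpTo-const0 zero = refl
  sumUpTo-const0 (suc m) = cong (_+ + 0) (sumUpTo-const0 m)

sumUpTo-distrib-+ : ∀ m (f g : ℕ → ℤ) →
  sumUpTo m (λ k → f k + g k) ≡ sumUpTo m f + sumUpTo m g
sumUpTo-distrib-+ zero f g = refl
sumUpTo-distrib-+ (suc m) f g =
  trans (cong (_+ (f (suc m) + g (suc m))) (sumUpTo-distrib-+ m f g))
        (+-interchange (sumUpTo m f) (sumUpTo m g) (f (suc m)) (g (suc m)))

*-distribˡ-sumUpTo : ∀ m x (f : ℕ → ℤ) → x * sumUpTo m f ≡ sumUpTo m (λ k → x * f k)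
*-distribˡ-sumUpTo zero x f = refl
*-distribˡ-sumUpTo (suc m) x f =
  trans (ℤP.*-distribˡ-+ x (sumUpTo m f) (f (suc m))) (cong (_+ x * f (suc m)) (*-distribˡ-sumUpTo m x f))

*-distribʳ-sumUpTo : ∀ m x (f : ℕ → ℤ) → sumUpTo m f * x ≡ sumUpTo m (λ k → f k * x)
*-distribʳ-sumUpTo zero x f = refl
*-distribʳ-sumUpTo (suc m) x f =
  trans (ℤP.*-distribʳ-+ x (sumUpTo m f) (f (suc m))) (cong (_+ f (suc m) * x) (*-distribʳ-sumUpTo m x f))

sumUpTo-suc : ∀ m (f : ℕ → ℤ) → sumUpTo (suc m) f ≡ f 0 + sumUpTo m (f ∘ suc)
sumUpTo-suc zero f = refl
sumUpTo-suc (suc m) f =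
  trans (cong (_+ f (suc (suc m))) (sumUpTo-suc m f)) (ℤP.+-assoc (f 0) _ _)

sumUpTo-head : ∀ m (f : ℕ → ℤ) → (∀ k → f (suc k) ≡ + 0) → sumUpTo m f ≡ f 0
sumUpTo-head zero f f≡0 = refl
sumUpTo-head (suc m) f f≡0 = begin
  sumUpTo (suc m) f         ≡⟨ sumUpTo-suc m f ⟩
  f 0 + sumUpTo m (f ∘ suc) ≡⟨ cong (λ t → f 0 + t) (sumUpTo-zero m (λ k _ → f≡0 k)) ⟩
  f 0 + + 0                 ≡⟨ ℤP.+-identityʳ (f 0) ⟩
  f 0                       ∎
  where open ≡-Reasoning

sumUpTo-reverse : ∀ m (f : ℕ → ℤ) → sumUpTo m f ≡ sumUpTo m (λ k → f (m ∸ k))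
sumUpTo-reverse zero f = refl
sumUpTo-reverse (suc m) f = begin
  sumUpTo m f + f (suc m)                       ≡⟨ cong (_+ f (suc m)) (sumUpTo-reverse m f) ⟩
  sumUpTo m (λ k → f (m ∸ k)) + f (suc m)       ≡⟨ ℤP.+-comm _ (f (suc m)) ⟩
  f (suc m) + sumUpTo m (λ k → f (m ∸ k))       ≡⟨ sumUpTo-suc m (λ k → f (suc m ∸ k)) ⟨
  sumUpTo (suc m) (λ k → f (suc m ∸ k))         ∎
  where open ≡-Reasoning

sumUpTo-suc-∸ : ∀ {j N} (f : ℕ → ℤ) → j ≤ N →
  sumUpTo (suc N ∸ j) f ≡ sumUpTo (N ∸ j) f + f (suc N ∸ j)
sumUpTo-suc-∸ {j} {N} f j≤N rewrite ℕP.+-∸-assoc 1 j≤N = refl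

sumUpTo-∸-self : ∀ N (f : ℕ → ℤ) → sumUpTo (N ∸ N) f ≡ f (N ∸ N)
sumUpTo-∸-self N f rewrite ℕP.n∸n≡0 N = refl

-- Summing over the triangle {(j , l) | j + l ≤ N} by diagonals or by rows.
sumUpTo-triangle : ∀ N (F : ℕ → ℕ → ℤ) →
  sumUpTo N (λ k → sumUpTo k (λ j → F j (k ∸ j))) ≡ sumUpTo N (λ j → sumUpTo (N ∸ j) (F j))
sumUpTo-triangle zero F = refl
sumUpTo-triangle (suc N) F = begin
  sumUpTo N diagonal + sumUpTo (suc N) (λ j → F j (suc N ∸ j))
    ≡⟨ cong (_+ sumUpTo (suc N) (λ j → F j (suc N ∸ j))) (sumUpTo-triangle N F) ⟩
  sumUpTo N row + (sumUpTo N (λ j → F j (suc N ∸ j)) + F (suc N) (N ∸ N))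
    ≡⟨ ℤP.+-assoc (sumUpTo N row) _ _ ⟨
  (sumUpTo N row + sumUpTo N (λ j → F j (suc N ∸ j))) + F (suc N) (N ∸ N)
    ≡⟨ cong (_+ F (suc N) (N ∸ N)) (sumUpTo-distrib-+ N row (λ j → F j (suc N ∸ j))) ⟨
  sumUpTo N (λ j → row j + F j (suc N ∸ j)) + F (suc N) (N ∸ N)
    ≡⟨ cong (_+ F (suc N) (N ∸ N)) (sumUpTo-cong N (λ j j≤N → sumUpTo-suc-∸ (F j) j≤N)) ⟨
  sumUpTo N (λ j → sumUpTo (suc N ∸ j) (F j)) + F (suc N) (N ∸ N)
    ≡⟨ cong (_+_ (sumUpTo N (λ j → sumUpTo (suc N ∸ j) (F j)))) (sumUpTo-∸-self N (F (suc N))) ⟨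
  sumUpTo N (λ j → sumUpTo (suc N ∸ j) (F j)) + sumUpTo (N ∸ N) (F (suc N))
    ∎
  where
  open ≡-Reasoning
  diagonal row : ℕ → ℤ
  diagonal k = sumUpTo k (λ j → F j (k ∸ j))
  row j = sumUpTo (N ∸ j) (F j)

-- Coefficients of products

sumBox-cong : ∀ n a {F G : Exp n → Exp n → ℤ} → (∀ b c → F b c ≡ G b c) → sumBox n a F ≡ sumBox n a G
sumBox-cong zero a F≡G = F≡G _ _
sumBox-cong (suc n) a F≡G = sumUpTo-cong (a Fin.zero) (λ k _ → sumBox-cong n (tail a) (λ b c → F≡G _ _))

sumBox-resp : ∀ n {a a'} (F : Exp n → Exp n → ℤ) → a ≗ a' → sumBox n a F ≡ sumBox n a' F
sumBox-resp zero F a≗a' = refl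
sumBox-resp (suc n) {a} {a'} F a≗a' rewrite a≗a' Fin.zero =
  sumUpTo-cong (a' Fin.zero) (λ k _ → sumBox-resp n _ (a≗a' ∘ Fin.suc))

sumBox-zero : ∀ n a (F : Exp n → Exp n → ℤ) →
  (∀ b c → (∀ i → b i ℕ.+ c i ≡ a i) → F b c ≡ + 0) → sumBox n a F ≡ + 0
sumBox-zero zero a F F≡0 = F≡0 _ _ (λ ())
sumBox-zero (suc n) a F F≡0 = sumUpTo-zero (a Fin.zero) λ k k≤a₀ →
  sumBox-zero n (tail a) _ λ b c b+c≡a → F≡0 _ _ λ where
    Fin.zero    → ℕP.m+[n∸m]≡n k≤a₀
    (Fin.suc i) → b+c≡a i

sumBox-distrib-+ : ∀ n a (F G : Exp n → Exp n → ℤ) →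
  sumBox n a (λ b c → F b c + G b c) ≡ sumBox n a F + sumBox n a G
sumBox-distrib-+ zero a F G = refl
sumBox-distrib-+ (suc n) a F G =
  trans (sumUpTo-cong (a Fin.zero) (λ k _ → sumBox-distrib-+ n (tail a) _ _)) (sumUpTo-distrib-+ (a Fin.zero) _ _)

sumBox-sumUpTo : ∀ n a m (F : ℕ → Exp n → Exp n → ℤ) →
  sumBox n a (λ b c → sumUpTo m (λ j → F j b c)) ≡ sumUpTo m (λ j → sumBox n a (F j))
sumBox-sumUpTo n a zero F = refl
sumBox-sumUpTo n a (suc m) F =
  trans (sumBox-distrib-+ n a _ _) (cong (_+ sumBox n a (F (suc m))) (sumBox-sumUpTo n a m F))

Coeffs : ℕ → Set
Coeffs n = Exp n → ℤ

Respects-≗ : ∀ {n} → Coeffs n → Set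
Respects-≗ f = ∀ {a b} → a ≗ b → f a ≡ f b

infixl 7 _⋆_
_⋆_ : ∀ {n} → Coeffs n → Coeffs n → Coeffs n
_⋆_ {n} f g a = sumBox n a (λ b c → f b * g c)

-- For n > 0, (f ⋆ g) a reduces to sumUpTo (a 0) (λ k → (slice f k ⋆ slice g (a 0 ∸ k)) (tail a)).
slice : ∀ {n} → Coeffs (suc n) → ℕ → Coeffs n
slice f k b = f (k ∷ b)

slice-resp : ∀ {n} {f : Coeffs (suc n)} → Respects-≗ f → ∀ k → Respects-≗ (slice f k)
slice-resp f-resp k b≗b' = f-resp λ where
  Fin.zero    → refl
  (Fin.suc i) → b≗b' i

⋆-cong : ∀ {n} {f f' g g' : Coeffs n} → f ≗ f' → g ≗ g' → f ⋆ g ≗ f' ⋆ g'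
⋆-cong {n} f≗f' g≗g' a = sumBox-cong n a (λ b c → cong₂ _*_ (f≗f' b) (g≗g' c))

⋆-distribˡ-+ : ∀ {n} (f g h : Coeffs n) → f ⋆ (λ a → g a + h a) ≗ λ a → (f ⋆ g) a + (f ⋆ h) a
⋆-distribˡ-+ {n} f g h a =
  trans (sumBox-cong n a (λ b c → ℤP.*-distribˡ-+ (f b) (g c) (h c))) (sumBox-distrib-+ n a _ _)

sumUpTo-⋆ : ∀ {n} m (G : ℕ → Coeffs n) (h : Coeffs n) →
  (λ b → sumUpTo m (λ j → G j b)) ⋆ h ≗ λ a → sumUpTo m (λ j → (G j ⋆ h) a)
sumUpTo-⋆ {n} m G h a =
  trans (sumBox-cong n a (λ b c → *-distribʳ-sumUpTo m (h c) (λ j → G j b))) (sumBox-sumUpTo n a m _)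

⋆-sumUpTo : ∀ {n} m (f : Coeffs n) (G : ℕ → Coeffs n) →
  f ⋆ (λ c → sumUpTo m (λ j → G j c)) ≗ λ a → sumUpTo m (λ j → (f ⋆ G j) a)
⋆-sumUpTo {n} m f G a =
  trans (sumBox-cong n a (λ b c → *-distribˡ-sumUpTo m (f b) (λ j → G j c))) (sumBox-sumUpTo n a m _)

⋆-comm : ∀ n (f g : Coeffs n) → Respects-≗ f → Respects-≗ g → f ⋆ g ≗ g ⋆ f
⋆-comm zero f g f-resp g-resp a =
  trans (ℤP.*-comm (f _) (g _)) (cong₂ _*_ (g-resp (λ ())) (f-resp (λ ())))
⋆-comm (suc n) f g f-resp g-resp a = begin
  sumUpTo a₀ (λ k → (slice f k ⋆ slice g (a₀ ∸ k)) (tail a))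
    ≡⟨ sumUpTo-cong a₀ (λ k _ → ⋆-comm n _ _ (slice-resp f-resp k) (slice-resp g-resp (a₀ ∸ k)) (tail a)) ⟩
  sumUpTo a₀ (λ k → (slice g (a₀ ∸ k) ⋆ slice f k) (tail a))
    ≡⟨ sumUpTo-reverse a₀ _ ⟩
  sumUpTo a₀ (λ k → (slice g (a₀ ∸ (a₀ ∸ k)) ⋆ slice f (a₀ ∸ k)) (tail a))
    ≡⟨ sumUpTo-cong a₀ (λ k k≤a₀ → cong (λ t → (slice g t ⋆ slice f (a₀ ∸ k)) (tail a)) (ℕP.m∸[m∸n]≡n k≤a₀)) ⟩
  sumUpTo a₀ (λ k → (slice g k ⋆ slice f (a₀ ∸ k)) (tail a))
    ∎
  where
  open ≡-Reasoning
  a₀ = a Fin.zero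

⋆-identityˡ : ∀ n (g : Coeffs n) → Respects-≗ g → coeff (con (+ 1)) ⋆ g ≗ g
⋆-identityˡ zero g g-resp a = trans (ℤP.*-identityˡ (g _)) (g-resp (λ ()))
⋆-identityˡ (suc n) g g-resp a = begin
  sumUpTo a₀ (λ k → (slice δ k ⋆ slice g (a₀ ∸ k)) (tail a))
    ≡⟨ sumUpTo-head a₀ _ (λ k → sumBox-zero n (tail a) _ (λ b c _ → ℤP.*-zeroˡ (slice g (a₀ ∸ suc k) c))) ⟩
  (coeff (con (+ 1)) ⋆ slice g a₀) (tail a)
    ≡⟨ ⋆-identityˡ n (slice g a₀) (slice-resp g-resp a₀) (tail a) ⟩
  g (a₀ ∷ tail a)
    ≡⟨ g-resp (λ { Fin.zero → refl ; (Fin.suc i) → refl }) ⟩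
  g a
    ∎
  where
  open ≡-Reasoning
  a₀ = a Fin.zero
  δ = coeff {suc n} (con (+ 1))

⋆-assoc : ∀ n (f g h : Coeffs n) → Respects-≗ f → Respects-≗ g → Respects-≗ h →
  (f ⋆ g) ⋆ h ≗ f ⋆ (g ⋆ h)
⋆-assoc zero f g h f-resp g-resp h-resp a = reassociate _ _
  where
  reassociate : ∀ b c → (f b * g c) * h c ≡ f b * (g b * h c)
  reassociate b c = trans (ℤP.*-assoc (f b) (g c) (h c)) (cong (λ t → f b * (t * h c)) (g-resp (λ ())))
⋆-assoc (suc n) f g h f-resp g-resp h-resp a = begin
  sumUpTo a₀ (λ k → ((λ b → sumUpTo k (λ j → (fⱼ j ⋆ gⱼ (k ∸ j)) b)) ⋆ hⱼ (a₀ ∸ k)) a')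
    ≡⟨ sumUpTo-cong a₀ (λ k _ → sumUpTo-⋆ k _ (hⱼ (a₀ ∸ k)) a') ⟩
  sumUpTo a₀ (λ k → sumUpTo k (λ j → ((fⱼ j ⋆ gⱼ (k ∸ j)) ⋆ hⱼ (a₀ ∸ k)) a'))
    ≡⟨ sumUpTo-cong a₀ (λ k _ → sumUpTo-cong k (λ j j≤k → reassociate j k j≤k)) ⟩
  sumUpTo a₀ (λ k → sumUpTo k (λ j → summand j (k ∸ j)))
    ≡⟨ sumUpTo-triangle a₀ summand ⟩
  sumUpTo a₀ (λ j → sumUpTo (a₀ ∸ j) (summand j))
    ≡⟨ sumUpTo-cong a₀ (λ j _ → sumUpTo-cong (a₀ ∸ j) (λ l _ →
         cong (λ t → (fⱼ j ⋆ (gⱼ l ⋆ hⱼ t)) a') (sym (ℕP.∸-+-assoc a₀ j l)))) ⟩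
  sumUpTo a₀ (λ j → sumUpTo (a₀ ∸ j) (λ l → (fⱼ j ⋆ (gⱼ l ⋆ hⱼ (a₀ ∸ j ∸ l))) a'))
    ≡⟨ sumUpTo-cong a₀ (λ j _ → ⋆-sumUpTo (a₀ ∸ j) (fⱼ j) (λ l → gⱼ l ⋆ hⱼ (a₀ ∸ j ∸ l)) a') ⟨
  sumUpTo a₀ (λ j → (fⱼ j ⋆ (λ c → sumUpTo (a₀ ∸ j) (λ l → (gⱼ l ⋆ hⱼ (a₀ ∸ j ∸ l)) c))) a')
    ∎
  where
  open ≡-Reasoning
  a₀ = a Fin.zero
  a' = tail a
  fⱼ gⱼ hⱼ : ℕ → Coeffs n
  fⱼ = slice f
  gⱼ = slice g
  hⱼ = slice h
  summand : ℕ → ℕ → ℤ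
  summand j l = (fⱼ j ⋆ (gⱼ l ⋆ hⱼ (a₀ ∸ (j ℕ.+ l)))) a'
  reassociate : ∀ j k → j ≤ k → ((fⱼ j ⋆ gⱼ (k ∸ j)) ⋆ hⱼ (a₀ ∸ k)) a' ≡ summand j (k ∸ j)
  reassociate j k j≤k =
    trans (⋆-assoc n _ _ _ (slice-resp f-resp j) (slice-resp g-resp _) (slice-resp h-resp _) a')
          (cong (λ t → (fⱼ j ⋆ (gⱼ (k ∸ j) ⋆ hⱼ (a₀ ∸ t))) a') (sym (ℕP.m+[n∸m]≡n j≤k)))

-- Polynomial expressions as a commutative ring

expEq-resp : ∀ n {a a' : Exp n} (b : Exp n) → a ≗ a' → expEq n a b ≡ expEq n a' b
expEq-resp zero b a≗a' = refl
expEq-resp (suc n) b a≗a' =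
  cong₂ _∧_ (cong (_≡ᵇ b Fin.zero) (a≗a' Fin.zero)) (expEq-resp n (b ∘ Fin.suc) (a≗a' ∘ Fin.suc))

coeff-resp : ∀ {n} (P : Poly n) → Respects-≗ (coeff P)
coeff-resp {n} (con c) a≗a' = cong (λ t → if t then c else + 0) (expEq-resp n zeroExp a≗a')
coeff-resp {n} (var i) a≗a' = cong (λ t → if t then + 1 else + 0) (expEq-resp n (unitExp i) a≗a')
coeff-resp (P ⊕ Q) a≗a' = cong₂ _+_ (coeff-resp P a≗a') (coeff-resp Q a≗a')
coeff-resp {n} (P ⊗ Q) a≗a' = sumBox-resp n _ a≗a'
coeff-resp (neg P) a≗a' = cong -_ (coeff-resp P a≗a')

coeff-con-0 : ∀ {n} (a : Exp n) → coeff {n} (con (+ 0)) a ≡ + 0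
coeff-con-0 {n} a with expEq n a zeroExp
... | true  = refl
... | false = refl

-- A record rather than a function type, so that P and Q can be inferred from a proof of P ≈ Q.
infix 4 _≈_
record _≈_ {n} (P Q : Poly n) : Set where
  constructor mk≈
  field coeff-≡ : coeff P ≗ coeff Q
open _≈_ public

module _ {n : ℕ} where

  ≈-isEquivalence : IsEquivalence (_≈_ {n})
  ≈-isEquivalence = record
    { refl  = mk≈ λ _ → refl
    ; sym   = λ P≈Q → mk≈ (sym ∘ coeff-≡ P≈Q)
    ; trans = λ P≈Q Q≈R → mk≈ λ a → trans (coeff-≡ P≈Q a) (coeff-≡ Q≈R a)
    }

  open IsEquivalence ≈-isEquivalence public
    using () renaming (refl to ≈-refl; sym to ≈-sym; trans to ≈-trans; reflexive to ≈-reflexive)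

  ≈-setoid : Setoid _ _
  ≈-setoid = record { isEquivalence = ≈-isEquivalence }

  open import Algebra.Consequences.Setoid ≈-setoid

  ⊕-cong : ∀ {P P' Q Q' : Poly n} → P ≈ P' → Q ≈ Q' → P ⊕ Q ≈ P' ⊕ Q'
  ⊕-cong P≈P' Q≈Q' = mk≈ λ a → cong₂ _+_ (coeff-≡ P≈P' a) (coeff-≡ Q≈Q' a)

  ⊗-cong : ∀ {P P' Q Q' : Poly n} → P ≈ P' → Q ≈ Q' → P ⊗ Q ≈ P' ⊗ Q'
  ⊗-cong P≈P' Q≈Q' = mk≈ (⋆-cong (coeff-≡ P≈P') (coeff-≡ Q≈Q'))

  neg-cong : ∀ {P P' : Poly n} → P ≈ P' → neg P ≈ neg P'
  neg-cong P≈P' = mk≈ (cong -_ ∘ coeff-≡ P≈P')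

  ⊕-assoc : ∀ (P Q R : Poly n) → (P ⊕ Q) ⊕ R ≈ P ⊕ (Q ⊕ R)
  ⊕-assoc P Q R = mk≈ λ a → ℤP.+-assoc (coeff P a) (coeff Q a) (coeff R a)

  ⊕-comm : ∀ (P Q : Poly n) → P ⊕ Q ≈ Q ⊕ P
  ⊕-comm P Q = mk≈ λ a → ℤP.+-comm (coeff P a) (coeff Q a)

  ⊕-identityˡ : ∀ (P : Poly n) → con (+ 0) ⊕ P ≈ P
  ⊕-identityˡ P = mk≈ λ a → trans (cong (_+ coeff P a) (coeff-con-0 a)) (ℤP.+-identityˡ (coeff P a))

  ⊕-inverseˡ : ∀ (P : Poly n) → neg P ⊕ P ≈ con (+ 0)
  ⊕-inverseˡ P = mk≈ λ a → trans (ℤP.+-inverseˡ (coeff P a)) (sym (coeff-con-0 a))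

  ⊗-assoc : ∀ (P Q R : Poly n) → (P ⊗ Q) ⊗ R ≈ P ⊗ (Q ⊗ R)
  ⊗-assoc P Q R = mk≈ (⋆-assoc n _ _ _ (coeff-resp P) (coeff-resp Q) (coeff-resp R))

  ⊗-comm : ∀ (P Q : Poly n) → P ⊗ Q ≈ Q ⊗ P
  ⊗-comm P Q = mk≈ (⋆-comm n _ _ (coeff-resp P) (coeff-resp Q))

  ⊗-identityˡ : ∀ (P : Poly n) → con (+ 1) ⊗ P ≈ P
  ⊗-identityˡ P = mk≈ (⋆-identityˡ n _ (coeff-resp P))

  ⊗-distribˡ-⊕ : ∀ (P Q R : Poly n) → P ⊗ (Q ⊕ R) ≈ P ⊗ Q ⊕ P ⊗ R
  ⊗-distribˡ-⊕ P Q R = mk≈ (⋆-distribˡ-+ (coeff P) (coeff Q) (coeff R))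

  isCommutativeRing : IsCommutativeRing _≈_ _⊕_ _⊗_ neg (con (+ 0)) (con (+ 1))
  isCommutativeRing = record
    { isRing = record
      { +-isAbelianGroup = record
        { isGroup = record
          { isMonoid = record
            { isSemigroup = record
              { isMagma = record { isEquivalence = ≈-isEquivalence ; ∙-cong = ⊕-cong }
              ; assoc = ⊕-assoc
              }
            ; identity = comm∧idˡ⇒id ⊕-comm ⊕-identityˡ
            }
          ; inverse = comm∧invˡ⇒inv ⊕-comm ⊕-inverseˡ
          ; ⁻¹-cong = neg-cong
          }
        ; comm = ⊕-comm
        }
      ; *-cong = ⊗-cong
      ; *-assoc = ⊗-assoc
      ; *-identity = comm∧idˡ⇒id ⊗-comm ⊗-identityˡ
      ; distrib = comm∧distrˡ⇒distr ⊕-cong ⊗-comm ⊗-distribˡ-⊕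
      }
    ; *-comm = ⊗-comm
    }

polyRing : ℕ → CommutativeRing _ _
polyRing n = record { isCommutativeRing = isCommutativeRing {n} }

con-neg : ∀ {n} x → con {n} (- x) ≈ neg (con x)
con-neg {n} x = mk≈ λ a → lemma (expEq n a zeroExp)
  where
  lemma : ∀ b → (if b then - x else + 0) ≡ - (if b then x else + 0)
  lemma true  = refl
  lemma false = refl

sign : ∀ {n} → ℕ → Poly n
sign j = con (ℤ.-1ℤ ℤ.^ j)

sign-suc : ∀ {n} j → sign {n} (suc j) ≈ neg (sign j)
sign-suc j = ≈-trans (≈-reflexive (cong con (ℤP.-1*i≡-i (ℤ.-1ℤ ℤ.^ j)))) (con-neg _)

module _ {n : ℕ} where

  open CommutativeRing (polyRing n)
    using ( 0#; 1#; +-assoc; +-comm; +-cong; +-congˡ; +-congʳ; +-identityˡ; +-identityʳ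
          ; *-cong; *-congˡ; *-congʳ; *-identityˡ; zeroʳ; distribˡ; distribʳ
          ; +-commutativeSemigroup; *-commutativeSemigroup )
  open import Algebra.Properties.CommutativeSemigroup *-commutativeSemigroup
    using () renaming (interchange to ⊗-interchange)
  open import Algebra.Properties.CommutativeSemigroup +-commutativeSemigroup
    using () renaming (interchange to ⊕-interchange)
  open import Relation.Binary.Reasoning.Setoid (≈-setoid {n})
  open import Tactic.RingSolver.NonReflective (fromCommutativeRing (polyRing n) (λ _ → nothing))
    using (solve; _⊜_) renaming (_⊕_ to _:+_; _⊗_ to _:*_; ⊝_ to :-_)

  sumP-cong : ∀ k {f g : Fin k → Poly n} → (∀ i → f i ≈ g i) → sumP k f ≈ sumP k g
  sumP-cong zero f≈g = ≈-refl
  sumP-cong (suc k) f≈g = +-cong (f≈g Fin.zero) (sumP-cong k (f≈g ∘ Fin.suc))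

  sumP-distrib-⊕ : ∀ k (f g : Fin k → Poly n) → sumP k (λ i → f i ⊕ g i) ≈ sumP k f ⊕ sumP k g
  sumP-distrib-⊕ zero f g = ≈-sym (+-identityʳ 0#)
  sumP-distrib-⊕ (suc k) f g =
    ≈-trans (+-congˡ (sumP-distrib-⊕ k (f ∘ Fin.suc) (g ∘ Fin.suc))) (⊕-interchange _ _ _ _)

  ⊗-distribˡ-sumP : ∀ k x (f : Fin k → Poly n) → x ⊗ sumP k f ≈ sumP k (λ i → x ⊗ f i)
  ⊗-distribˡ-sumP zero x f = zeroʳ x
  ⊗-distribˡ-sumP (suc k) x f = ≈-trans (distribˡ x _ _) (+-congˡ (⊗-distribˡ-sumP k x (f ∘ Fin.suc)))

  sumP-snoc : ∀ k (g : ℕ → Poly n) → sumP (suc k) (λ i → g (toℕ i)) ≈ sumP k (λ i → g (toℕ i)) ⊕ g k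
  sumP-snoc zero g = ≈-trans (+-identityʳ (g 0)) (≈-sym (+-identityˡ (g 0)))
  sumP-snoc (suc k) g = ≈-trans (+-congˡ (sumP-snoc k (g ∘ suc))) (≈-sym (+-assoc _ _ _))

  prodP-⊗ : ∀ k (f g : Fin k → Poly n) → prodP k (λ i → f i ⊗ g i) ≈ prodP k f ⊗ prodP k g
  prodP-⊗ zero f g = ≈-sym (*-identityˡ (con (+ 1)))
  prodP-⊗ (suc k) f g =
    ≈-trans (*-congˡ (prodP-⊗ k (f ∘ Fin.suc) (g ∘ Fin.suc))) (⊗-interchange _ _ _ _)

  elemSym-0 : ∀ k (f : Fin k → Poly n) → elemSym k f 0 ≈ con (+ 1)
  elemSym-0 zero f = ≈-refl
  elemSym-0 (suc k) f = ≈-refl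

  elemSym-vanish : ∀ k (f : Fin k → Poly n) j → k < j → elemSym k f j ≈ con (+ 0)
  elemSym-vanish zero f (suc j) _ = ≈-refl
  elemSym-vanish (suc k) f (suc j) (s≤s k<j) = begin
    f Fin.zero ⊗ elemSym k f' j ⊕ elemSym k f' (suc j)
      ≈⟨ +-cong (*-congˡ (elemSym-vanish k f' j k<j)) (elemSym-vanish k f' (suc j) (ℕP.m<n⇒m<1+n k<j)) ⟩
    f Fin.zero ⊗ con (+ 0) ⊕ con (+ 0)
      ≈⟨ +-identityʳ _ ⟩
    f Fin.zero ⊗ con (+ 0)
      ≈⟨ zeroʳ _ ⟩
    con (+ 0)
      ∎
    where f' = f ∘ Fin.suc

  prodP≈elemSym : ∀ k (f : Fin k → Poly n) → prodP k f ≈ elemSym k f k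
  prodP≈elemSym zero f = ≈-refl
  prodP≈elemSym (suc k) f = begin
    f Fin.zero ⊗ prodP k f'                              ≈⟨ *-congˡ (prodP≈elemSym k f') ⟩
    f Fin.zero ⊗ elemSym k f' k                          ≈⟨ +-identityʳ _ ⟨
    f Fin.zero ⊗ elemSym k f' k ⊕ con (+ 0)              ≈⟨ +-congˡ (elemSym-vanish k f' (suc k) ℕP.≤-refl) ⟨
    f Fin.zero ⊗ elemSym k f' k ⊕ elemSym k f' (suc k)   ∎
    where f' = f ∘ Fin.suc

  prodP-1⊖ : ∀ k (f : Fin k → Poly n) →
    prodP k (λ i → con (+ 1) ⊖ f i) ≈ con (+ 1) ⊕ sumP k (λ i → sign (suc (toℕ i)) ⊗ elemSym k f (suc (toℕ i)))
  prodP-1⊖ zero f = ≈-sym (+-identityʳ 1#)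
  prodP-1⊖ (suc K) f = begin
    (1# ⊖ f₀) ⊗ prodP K (λ i → 1# ⊖ f' i)
      ≈⟨ *-congˡ (prodP-1⊖ K f') ⟩
    (1# ⊖ f₀) ⊗ (1# ⊕ U)
      ≈⟨ distribʳ (1# ⊕ U) 1# (neg f₀) ⟩
    1# ⊗ (1# ⊕ U) ⊕ neg f₀ ⊗ (1# ⊕ U)
      ≈⟨ +-congʳ (*-identityˡ (1# ⊕ U)) ⟩
    (1# ⊕ U) ⊕ neg f₀ ⊗ (1# ⊕ U)
      ≈⟨ solve 3 (λ e u x → ((e :+ u) :+ x) ⊜ (e :+ (x :+ u))) ≈-refl 1# U (neg f₀ ⊗ (1# ⊕ U)) ⟩
    1# ⊕ (neg f₀ ⊗ (1# ⊕ U) ⊕ U)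
      ≈⟨ +-congˡ (+-cong lower-terms top-terms) ⟨
    1# ⊕ (sumP (suc K) (λ i → sign (suc (toℕ i)) ⊗ (f₀ ⊗ E' (toℕ i))) ⊕ sumP (suc K) (λ i → g (toℕ i)))
      ≈⟨ +-congˡ (sumP-distrib-⊕ (suc K) (λ i → sign (suc (toℕ i)) ⊗ (f₀ ⊗ E' (toℕ i))) (λ i → g (toℕ i))) ⟨
    1# ⊕ sumP (suc K) (λ i → sign (suc (toℕ i)) ⊗ (f₀ ⊗ E' (toℕ i)) ⊕ g (toℕ i))
      ≈⟨ +-congˡ (sumP-cong (suc K) (λ i → distribˡ (sign (suc (toℕ i))) (f₀ ⊗ E' (toℕ i)) (E' (suc (toℕ i))))) ⟨
    1# ⊕ sumP (suc K) (λ i → sign (suc (toℕ i)) ⊗ elemSym (suc K) f (suc (toℕ i)))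
      ∎
    where
    f₀ = f Fin.zero
    f' = f ∘ Fin.suc
    E' = elemSym K f'
    g : ℕ → Poly n
    g j = sign (suc j) ⊗ E' (suc j)
    U = sumP K (λ i → g (toℕ i))
    lower-terms : sumP (suc K) (λ i → sign (suc (toℕ i)) ⊗ (f₀ ⊗ E' (toℕ i))) ≈ neg f₀ ⊗ (1# ⊕ U)
    lower-terms = begin
      sumP (suc K) (λ i → sign (suc (toℕ i)) ⊗ (f₀ ⊗ E' (toℕ i)))
        ≈⟨ sumP-cong (suc K) (λ i → ≈-trans (*-congʳ (sign-suc (toℕ i))) (swap (sign (toℕ i)) f₀ (E' (toℕ i)))) ⟩
      sumP (suc K) (λ i → neg f₀ ⊗ (sign (toℕ i) ⊗ E' (toℕ i)))
        ≈⟨ ⊗-distribˡ-sumP (suc K) (neg f₀) (λ i → sign (toℕ i) ⊗ E' (toℕ i)) ⟨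
      neg f₀ ⊗ (sign 0 ⊗ E' 0 ⊕ U)
        ≈⟨ *-congˡ (+-congʳ (≈-trans (*-congˡ (elemSym-0 K f')) (*-identityˡ 1#))) ⟩
      neg f₀ ⊗ (1# ⊕ U)
        ∎
      where
      swap : ∀ c x y → neg c ⊗ (x ⊗ y) ≈ neg x ⊗ (c ⊗ y)
      swap = solve 3 (λ c x y → ((:- c) :* (x :* y)) ⊜ ((:- x) :* (c :* y))) ≈-refl
    top-terms : sumP (suc K) (λ i → g (toℕ i)) ≈ U
    top-terms = begin
      sumP (suc K) (λ i → g (toℕ i))
        ≈⟨ sumP-snoc K g ⟩
      U ⊕ g K
        ≈⟨ +-congˡ (≈-trans (*-congˡ (elemSym-vanish K f' (suc K) ℕP.≤-refl)) (zeroʳ _)) ⟩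
      U ⊕ 0#
        ≈⟨ +-identityʳ U ⟩
      U ∎

  prodX≈e : prodX n ≈ e n n
  prodX≈e = prodP≈elemSym n var

  min3A≈min3B : min3A n ≈ min3B n
  min3A≈min3B = begin
    prodP n (λ i → var i ⊗ var i) ⊕ prodP n (λ i → var i ⊗ (1# ⊖ var i))
      ≈⟨ +-cong (prodP-⊗ n var var) (prodP-⊗ n var (λ i → 1# ⊖ var i)) ⟩
    prodX n ⊗ prodX n ⊕ prodX n ⊗ prodP n (λ i → 1# ⊖ var i)
      ≈⟨ +-cong (*-cong prodX≈e prodX≈e) (*-cong prodX≈e (prodP-1⊖ n var)) ⟩
    E ⊗ E ⊕ E ⊗ (1# ⊕ S)
      ≈⟨ +-comm (E ⊗ E) (E ⊗ (1# ⊕ S)) ⟩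
    E ⊗ (1# ⊕ S) ⊕ E ⊗ E
      ≈⟨ distribˡ E (1# ⊕ S) E ⟨
    E ⊗ (1# ⊕ S ⊕ E)
      ∎
    where
    E = e n n
    S = sumP n (λ i → sign (suc (toℕ i)) ⊗ e n (suc (toℕ i)))

-- Degree in one variable

expEq-sound : ∀ n {a b : Exp n} → T (expEq n a b) → a ≗ b
expEq-sound (suc n) {a} {b} a≟b Fin.zero = ℕP.≡ᵇ⇒≡ (a Fin.zero) (b Fin.zero) (proj₁ (Equivalence.to T-∧ a≟b))
expEq-sound (suc n) a≟b (Fin.suc i) = expEq-sound n (proj₂ (Equivalence.to T-∧ a≟b)) i

if-then-0 : ∀ {b} (x : ℤ) → ¬ T b → (if b then x else + 0) ≡ + 0
if-then-0 {false} x _ = refl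
if-then-0 {true}  x ¬t = contradiction _ ¬t

record DegIn≤ {n} (i : Fin n) (d : ℕ) (P : Poly n) : Set where
  constructor degIn≤
  field coeff-vanish : ∀ a → d < a i → coeff P a ≡ + 0
open DegIn≤

module _ {n : ℕ} (i : Fin n) where

  DegIn≤-con : ∀ {d} c → DegIn≤ i d (con c)
  DegIn≤-con {d} c = degIn≤ λ a d<aᵢ → if-then-0 c λ a≟0 → ℕP.n≮0 (subst (d <_) (expEq-sound n a≟0 i) d<aᵢ)

  DegIn≤-var : ∀ j → DegIn≤ i (unitExp j i) (var j)
  DegIn≤-var j = degIn≤ λ a d<aᵢ → if-then-0 (+ 1) λ a≟eⱼ → ℕP.<-irrefl (sym (expEq-sound n a≟eⱼ i)) d<aᵢ

  DegIn≤-⊕ : ∀ {d P Q} → DegIn≤ i d P → DegIn≤ i d Q → DegIn≤ i d (P ⊕ Q)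
  DegIn≤-⊕ degP degQ = degIn≤ λ a d<aᵢ → cong₂ _+_ (coeff-vanish degP a d<aᵢ) (coeff-vanish degQ a d<aᵢ)

  DegIn≤-neg : ∀ {d P} → DegIn≤ i d P → DegIn≤ i d (neg P)
  DegIn≤-neg degP = degIn≤ λ a d<aᵢ → cong -_ (coeff-vanish degP a d<aᵢ)

  DegIn≤-⊗ : ∀ {d₁ d₂ P Q} → DegIn≤ i d₁ P → DegIn≤ i d₂ Q → DegIn≤ i (d₁ ℕ.+ d₂) (P ⊗ Q)
  DegIn≤-⊗ {d₁} {d₂} {P} {Q} degP degQ = degIn≤ λ a d<aᵢ →
    sumBox-zero n a _ λ b c b+c≡a → term-vanishes a d<aᵢ b c (b+c≡a i)
    where
    term-vanishes : ∀ a → d₁ ℕ.+ d₂ < a i → ∀ b c → b i ℕ.+ c i ≡ a i → coeff P b * coeff Q c ≡ + 0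
    term-vanishes a d<aᵢ b c b+c≡a with b i ℕ.≤? d₁ | c i ℕ.≤? d₂
    ... | no bᵢ≰d₁ | _ = trans (cong (_* coeff Q c) (coeff-vanish degP b (ℕP.≰⇒> bᵢ≰d₁))) (ℤP.*-zeroˡ (coeff Q c))
    ... | yes _ | no cᵢ≰d₂ = trans (cong (coeff P b *_) (coeff-vanish degQ c (ℕP.≰⇒> cᵢ≰d₂))) (ℤP.*-zeroʳ (coeff P b))
    ... | yes bᵢ≤d₁ | yes cᵢ≤d₂ = contradiction (subst (_≤ d₁ ℕ.+ d₂) b+c≡a (ℕP.+-mono-≤ bᵢ≤d₁ cᵢ≤d₂)) (ℕP.<⇒≱ d<aᵢ)

  DegIn≤-prodP : ∀ k (f : Fin k → Poly n) (d : Fin k → ℕ) → (∀ j → DegIn≤ i (d j) (f j)) → DegIn≤ i (sum d) (prodP k f)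
  DegIn≤-prodP zero f d degf = DegIn≤-con (+ 1)
  DegIn≤-prodP (suc k) f d degf = DegIn≤-⊗ (degf Fin.zero) (DegIn≤-prodP k (f ∘ Fin.suc) (d ∘ Fin.suc) (degf ∘ Fin.suc))

sum-unitExp : ∀ k (i : Fin k) (h : ℕ → ℕ) → h 0 ≡ 0 → sum (λ j → h (unitExp j i)) ≡ h 1
sum-unitExp (suc k) Fin.zero h h0≡0 = begin
  h 1 ℕ.+ sum {k} (λ _ → h 0) ≡⟨ cong (λ t → h 1 ℕ.+ sum {k} (λ _ → t)) h0≡0 ⟩
  h 1 ℕ.+ sum {k} (λ _ → 0)   ≡⟨ cong (h 1 ℕ.+_) (sum-zeros k) ⟩
  h 1 ℕ.+ 0                   ≡⟨ ℕP.+-identityʳ (h 1) ⟩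
  h 1                         ∎
  where
  open ≡-Reasoning
  sum-zeros : ∀ k → sum {k} (λ _ → 0) ≡ 0
  sum-zeros zero = refl
  sum-zeros (suc k) = sum-zeros k
sum-unitExp (suc k) (Fin.suc i) h h0≡0 = trans (cong (ℕ._+ sum (λ j → h (unitExp j i))) h0≡0) (sum-unitExp k i h h0≡0)

-- The j-th factor has degree at most h 1 in x_i if j = i, and h 0 = 0 otherwise.
DegIn≤-prodP-diagonal : ∀ {n} (i : Fin n) (f : Fin n → Poly n) (h : ℕ → ℕ) → h 0 ≡ 0 →
  (∀ j → DegIn≤ i (h (unitExp j i)) (f j)) → DegIn≤ i (h 1) (prodP n f)
DegIn≤-prodP-diagonal {n} i f h h0≡0 degf =
  subst (λ d → DegIn≤ i d (prodP n f)) (sum-unitExp n i h h0≡0) (DegIn≤-prodP i n f _ degf)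

-- Values at points of 𝔽_p^n

-- A record, so that x and y can be inferred: x ≡ y [mod p ] unfolds to a statement about ∣ x - y ∣.
record ModEq (p : ℕ) (x y : ℤ) : Set where
  constructor modEq
  field divisible : + p ℤD.∣ x - y
open ModEq

ModEq⇒≡-mod : ∀ {p x y} → ModEq p x y → x ≡ y [mod p ]
ModEq⇒≡-mod = ℤD.∣⇒∣ᵤ ∘ divisible

module _ {p : ℕ} where

  ≡⇒ModEq : ∀ {x y} → x ≡ y → ModEq p x y
  ≡⇒ModEq {x} refl = modEq (ℤD.divides (+ 0) (ℤP.+-inverseʳ x))

  ModEq-trans : ∀ {x y z} → ModEq p x y → ModEq p y z → ModEq p x z
  ModEq-trans {x} {y} {z} (modEq p∣x-y) (modEq p∣y-z) =
    modEq (subst (+ p ℤD.∣_) (split x y z) (ℤD.∣m∣n⇒∣m+n p∣x-y p∣y-z))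
    where
    split : ∀ (x y z : ℤ) → (x - y) + (y - z) ≡ x - z
    split = solve-∀

  +-cong-ModEq : ∀ {x x' y y'} → ModEq p x x' → ModEq p y y' → ModEq p (x + y) (x' + y')
  +-cong-ModEq {x} {x'} {y} {y'} (modEq p∣x-x') (modEq p∣y-y') =
    modEq (subst (+ p ℤD.∣_) (split x x' y y') (ℤD.∣m∣n⇒∣m+n p∣x-x' p∣y-y'))
    where
    split : ∀ (x x' y y' : ℤ) → (x - x') + (y - y') ≡ (x + y) - (x' + y')
    split = solve-∀

  *-cong-ModEq : ∀ {x x' y y'} → ModEq p x x' → ModEq p y y' → ModEq p (x * y) (x' * y')
  *-cong-ModEq {x} {x'} {y} {y'} (modEq p∣x-x') (modEq p∣y-y') =
    modEq (subst (+ p ℤD.∣_) (split x x' y y') (ℤD.∣m∣n⇒∣m+n (ℤD.∣m⇒∣m*n y p∣x-x') (ℤD.∣n⇒∣m*n x' p∣y-y')))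
    where
    split : ∀ (x x' y y' : ℤ) → (x - x') * y + x' * (y - y') ≡ x * y - x' * y'
    split = solve-∀

≈⇒PolyEq : ∀ p {n} {P Q : Poly n} → P ≈ Q → PolyEq p P Q
≈⇒PolyEq p P≈Q a = ModEq⇒≡-mod (≡⇒ModEq (coeff-≡ P≈Q a))

DegIn≤⇒ReducedDeg : ∀ d {n} {P : Poly n} → (∀ i → DegIn≤ i d P) → ReducedDeg (suc d) P
DegIn≤⇒ReducedDeg d deg a (i , d<aᵢ) = ModEq⇒≡-mod (≡⇒ModEq (coeff-vanish (deg i) a d<aᵢ))

𝟙≤ : ℕ → ℕ → ℤ
𝟙≤ d t = if d ℕ.≤ᵇ t then + 1 else + 0

𝟙≤-⊓ : ∀ d s t → 𝟙≤ d (s ⊓ t) ≡ 𝟙≤ d s * 𝟙≤ d t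
𝟙≤-⊓ d s t with d ℕ.≤ᵇ s | ℕP.≤ᵇ-reflects-≤ d s | d ℕ.≤ᵇ t | ℕP.≤ᵇ-reflects-≤ d t
                | d ℕ.≤ᵇ s ⊓ t | ℕP.≤ᵇ-reflects-≤ d (s ⊓ t)
... | true  | ofʸ d≤s | true  | ofʸ d≤t | false | ofⁿ d≰s⊓t = contradiction (ℕP.⊓-glb d≤s d≤t) d≰s⊓t
... | false | ofⁿ d≰s | _     | _       | true  | ofʸ d≤s⊓t = contradiction (ℕP.≤-trans d≤s⊓t (ℕP.m⊓n≤m s t)) d≰s
... | true  | _       | false | ofⁿ d≰t | true  | ofʸ d≤s⊓t = contradiction (ℕP.≤-trans d≤s⊓t (ℕP.m⊓n≤n s t)) d≰t
... | true  | _       | true  | _       | true  | _ = refl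
... | true  | _       | false | _       | false | _ = refl
... | false | _       | _     | _       | false | _ = refl

minF-< : ∀ {p} m (y : Fin (suc m) → Fin p) → minF m y < p
minF-< zero y = FinP.toℕ<n (y Fin.zero)
minF-< (suc m) y = ℕP.≤-<-trans (ℕP.m⊓n≤m _ _) (FinP.toℕ<n (y Fin.zero))

eval-prodP-𝟙≤ : ∀ {p q N} m (f : Fin (suc m) → Poly N) x (y : Fin (suc m) → Fin p) d →
  (∀ j → ModEq q (eval (f j) x) (𝟙≤ d (toℕ (y j)))) → ModEq q (eval (prodP (suc m) f) x) (𝟙≤ d (minF m y))
eval-prodP-𝟙≤ zero f x y d f≡𝟙 =
  ModEq-trans (≡⇒ModEq (ℤP.*-identityʳ (eval (f Fin.zero) x))) (f≡𝟙 Fin.zero)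
eval-prodP-𝟙≤ (suc m) f x y d f≡𝟙 =
  ModEq-trans (*-cong-ModEq (f≡𝟙 Fin.zero) (eval-prodP-𝟙≤ m (f ∘ Fin.suc) x (y ∘ Fin.suc) d (f≡𝟙 ∘ Fin.suc)))
              (≡⇒ModEq (sym (𝟙≤-⊓ d (toℕ (y Fin.zero)) (minF m (y ∘ Fin.suc)))))

𝟙≤1-below-2 : ∀ v → v < 2 → 𝟙≤ 1 v ≡ + v
𝟙≤1-below-2 0 _ = refl
𝟙≤1-below-2 1 _ = refl
𝟙≤1-below-2 (suc (suc _)) (s≤s (s≤s ()))

𝟙≤1+𝟙≤2-below-3 : ∀ v → v < 3 → 𝟙≤ 1 v + 𝟙≤ 2 v ≡ + v
𝟙≤1+𝟙≤2-below-3 0 _ = refl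
𝟙≤1+𝟙≤2-below-3 1 _ = refl
𝟙≤1+𝟙≤2-below-3 2 _ = refl
𝟙≤1+𝟙≤2-below-3 (suc (suc (suc _))) (s≤s (s≤s (s≤s ())))

square-ModEq-𝟙≤1 : ∀ (t : Fin 3) → ModEq 3 (+ toℕ t * + toℕ t) (𝟙≤ 1 (toℕ t))
square-ModEq-𝟙≤1 Fin.zero                       = modEq (ℤD.divides (+ 0) refl)
square-ModEq-𝟙≤1 (Fin.suc Fin.zero)             = modEq (ℤD.divides (+ 0) refl)
square-ModEq-𝟙≤1 (Fin.suc (Fin.suc Fin.zero))   = modEq (ℤD.divides (+ 1) refl)

x[1-x]-ModEq-𝟙≤2 : ∀ (t : Fin 3) → ModEq 3 (+ toℕ t * (+ 1 - + toℕ t)) (𝟙≤ 2 (toℕ t))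
x[1-x]-ModEq-𝟙≤2 Fin.zero                       = modEq (ℤD.divides (+ 0) refl)
x[1-x]-ModEq-𝟙≤2 (Fin.suc Fin.zero)             = modEq (ℤD.divides (+ 0) refl)
x[1-x]-ModEq-𝟙≤2 (Fin.suc (Fin.suc Fin.zero))   = modEq (ℤD.divides (- + 1) refl)

prodX-DegIn≤1 : ∀ {n} (i : Fin n) → DegIn≤ i 1 (prodX n)
prodX-DegIn≤1 i = DegIn≤-prodP-diagonal i var id refl (DegIn≤-var i)

min3A-DegIn≤2 : ∀ {n} (i : Fin n) → DegIn≤ i 2 (min3A n)
min3A-DegIn≤2 i = DegIn≤-⊕ i
  (DegIn≤-prodP-diagonal i _ double refl λ j → DegIn≤-⊗ i (DegIn≤-var i j) (DegIn≤-var i j))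
  (DegIn≤-prodP-diagonal i _ double refl λ j →
    DegIn≤-⊗ i (DegIn≤-var i j) (DegIn≤-⊕ i (DegIn≤-con i (+ 1)) (DegIn≤-neg i (DegIn≤-var i j))))
  where
  double : ℕ → ℕ
  double k = k ℕ.+ k

prodX-minimal : ∀ m → MinimalPolyExpr 2 (suc m) (minF m) (prodX (suc m))
prodX-minimal m = DegIn≤⇒ReducedDeg 1 prodX-DegIn≤1 , λ x → ModEq⇒≡-mod (ModEq-trans
  (eval-prodP-𝟙≤ m var (toℤpt x) x 1 (λ j → ≡⇒ModEq (sym (𝟙≤1-below-2 _ (FinP.toℕ<n (x j))))))
  (≡⇒ModEq (𝟙≤1-below-2 _ (minF-< m x))))

min3A-minimal : ∀ m → MinimalPolyExpr 3 (suc m) (minF m) (min3A (suc m))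
min3A-minimal m = DegIn≤⇒ReducedDeg 2 min3A-DegIn≤2 , λ x → ModEq⇒≡-mod (ModEq-trans
  (+-cong-ModEq (eval-prodP-𝟙≤ m (λ j → var j ⊗ var j) (toℤpt x) x 1 (square-ModEq-𝟙≤1 ∘ x))
                (eval-prodP-𝟙≤ m (λ j → var j ⊗ (con (+ 1) ⊖ var j)) (toℤpt x) x 2 (x[1-x]-ModEq-𝟙≤2 ∘ x)))
  (≡⇒ModEq (𝟙≤1+𝟙≤2-below-3 _ (minF-< m x))))

corollary3p4 : (m : ℕ) →
    let n = suc m in
      (MinimalPolyExpr 2 n (minF m) (prodX n) × PolyEq 2 (prodX n) (e n n))
      × (MinimalPolyExpr 3 n (minF m) (min3A n) × PolyEq 3 (min3A n) (min3B n))
corollary3p4 m = (prodX-minimal m , ≈⇒PolyEq 2 prodX≈e) , (min3A-minimal m , ≈⇒PolyEq 3 min3A≈min3B)
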